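{- Let $P=\Delta^1\times\Delta^1\times\Delta^2$ and let $\mathbf z$ be the center of $P$, which in standard coordinates is $(1/2,1/2;\,1/2,1/2;\,1/3,1/3,1/3)$. Any class $2$ simplex of a cover of $P$ contains $\mathbf z$ in the relative interior of one of its facets.
   Context: $\Delta^d$ is the convex hull of the standard unit vectors of $\mathbb{R}^{d+1}$; $P$ is $4$-dimensional and its vertices are its $0/1$ points. A cover of $P$ is a collection of $4$-simplices, each spanned by vertices of $P$, whose union is $P$. The class of a $4$-simplex with vertices among vertices of $P$ is $|\det[\mathbf 1\mid M_{\mathbf v}]|$, where the rows of $M_{\mathbf v}$ are the reduced coordinates of its vertices with respect to a vertex $\mathbf v$ of $P$ (delete in each factor the coordinate where $\mathbf v$ equals $1$), i.e. $4!$ times its volume in reduced coordinates. The center of $P$ is the point fixed by all affine automorphisms of $P$. -}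

module Defs where

open import Data.Nat using (ℕ; zero; suc)
open import Data.Fin using (Fin; zero; suc; punchIn; toℕ)
open import Data.Fin.Properties using (_≟_)
open import Data.Integer as ℤ using (ℤ; +_; -_)
open import Data.Rational as ℚ using (ℚ; 0ℚ; 1ℚ; _≤_; _<_)
open import Data.Product using (Σ; _×_; ∃; ∃-syntax)
open import Data.List using (List)
open import Data.List.Membership.Propositional using (_∈_)
open import Relation.Nullary using (¬_; yes; no)
open import Relation.Binary.PropositionalEquality using (_≡_)

sumℚ : {n : ℕ} → (Fin n → ℚ) → ℚ
sumℚ {zero}  f = 0ℚ
sumℚ {suc n} f = f zero ℚ.+ sumℚ (λ i → f (suc i))

sumℤ : {n : ℕ} → (Fin n → ℤ) → ℤ
sumℤ {zero}  f = + 0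
sumℤ {suc n} f = f zero ℤ.+ sumℤ (λ i → f (suc i))

sgn : ℕ → ℤ
sgn zero          = + 1
sgn (suc zero)    = - (+ 1)
sgn (suc (suc n)) = sgn n

det : {n : ℕ} → (Fin n → Fin n → ℤ) → ℤ
det {zero}  M = + 1
det {suc n} M =
  sumℤ (λ j → sgn (toℕ j) ℤ.* (M zero j ℤ.* det (λ r c → M (suc r) (punchIn j c))))

-- P = Δ¹ × Δ¹ × Δ² ⊂ ℝ² × ℝ² × ℝ³ = ℝ⁷.
-- A vertex of P (a 0/1 point of P) is determined by the position of the
-- coordinate equal to 1 in each factor.

Vertex : Set
Vertex = Fin 2 × Fin 2 × Fin 3

data Coord : Set where
  c₁ : Fin 2 → Coord
  c₂ : Fin 2 → Coord
  c₃ : Fin 3 → Coord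

Point : Set
Point = Coord → ℚ

δ : {n : ℕ} → Fin n → Fin n → ℚ
δ i k with i ≟ k
... | yes _ = 1ℚ
... | no  _ = 0ℚ

vertexPt : Vertex → Point
vertexPt (a Data.Product., b Data.Product., c) (c₁ k) = δ a k
vertexPt (a Data.Product., b Data.Product., c) (c₂ k) = δ b k
vertexPt (a Data.Product., b Data.Product., c) (c₃ k) = δ c k

InP : Point → Set
InP x = (∀ k → 0ℚ ≤ x k)
      × sumℚ (λ k → x (c₁ k)) ≡ 1ℚ
      × sumℚ (λ k → x (c₂ k)) ≡ 1ℚ
      × sumℚ (λ k → x (c₃ k)) ≡ 1ℚ

center : Point
center (c₁ _) = ℚ.½
center (c₂ _) = ℚ.½
center (c₃ _) = + 1 ℚ./ 3

Simplex : Set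
Simplex = Fin 5 → Vertex

comb : Simplex → (Fin 5 → ℚ) → Point
comb S λc k = sumℚ (λ i → λc i ℚ.* vertexPt (S i) k)

AffIndep : Simplex → Set
AffIndep S = ∀ (μ : Fin 5 → ℚ) → sumℚ μ ≡ 0ℚ → (∀ k → comb S μ k ≡ 0ℚ) →
             ∀ i → μ i ≡ 0ℚ

InSimplex : Point → Simplex → Set
InSimplex x S = ∃[ λc ] ((∀ i → 0ℚ ≤ λc i) × sumℚ λc ≡ 1ℚ × (∀ k → x k ≡ comb S λc k))

InRelIntFacet : Point → Simplex → Fin 5 → Set
InRelIntFacet x S i =
  ∃[ λc ] (λc i ≡ 0ℚ × (∀ j → ¬ (j ≡ i) → 0ℚ < λc j) × sumℚ λc ≡ 1ℚ
           × (∀ k → x k ≡ comb S λc k))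

-- A cover of P: a finite collection of 4-simplices spanned by vertices of P
-- whose union is P. (Each such simplex lies in P; the union condition is
-- checked on rational points.)
IsCover : List Simplex → Set
IsCover L = (∀ S → S ∈ L → AffIndep S)
          × (∀ x → InP x → ∃[ S ] (S ∈ L × InSimplex x S))

-- reduced coordinates of e_i in Δ^d wrt e_a: delete coordinate a
red : {d : ℕ} → Fin (suc d) → Fin (suc d) → Fin d → ℤ
red a i j with i ≟ punchIn a j
... | yes _ = + 1
... | no  _ = + 0

-- row [1 | reduced coordinates of w] (1 + 1 + 1 + 2 = 5 entries)
row : Vertex → Vertex → Fin 5 → ℤ
row (a Data.Product., b Data.Product., c) (a' Data.Product., b' Data.Product., c') zero = + 1
row (a Data.Product., b Data.Product., c) (a' Data.Product., b' Data.Product., c') (suc zero) = red a a' zero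
row (a Data.Product., b Data.Product., c) (a' Data.Product., b' Data.Product., c') (suc (suc zero)) = red b b' zero
row (a Data.Product., b Data.Product., c) (a' Data.Product., b' Data.Product., c') (suc (suc (suc j))) = red c c' j

classWrt : Vertex → Simplex → ℕ
classWrt v S = ℤ.∣ det (λ i → row v (S i)) ∣

module Submission where

-- Every simplex of class 2 spanned by vertices of P = Δ¹ × Δ¹ × Δ² contains the
-- centre of P in the relative interior of a facet. The class is |det| of the rows [1 | reduced coordinates], so:
--   1. The Laplace-expansion determinant of any size is alternating: expanding
--      along two rows pairs the terms of each unordered pair of columns with
--      opposite signs.
--   2. Hence class and "centre on a facet" are invariant under reordering the
--      vertices, and a repeated vertex gives class 0.
--   3. Bubble-sort induction reduces the claim to simplices whose vertices are
--      strictly decreasing in a numbering 0 … 11 of the vertices of P.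
--   4. For these C(12,5) = 792 tuples a computation shows that class 2 with
--      respect to any vertex means class 2 with respect to v₀ = (0,0,0), and that
--      Cramer's rule then yields barycentric coordinates of the centre certifying
--      that it lies in the relative interior of a facet.

open import Defs
open import Algebra.Bundles using (CommutativeMonoid)
open import Data.Fin using (Fin; zero; suc; punchIn; toℕ; inject₁; combine)
open import Data.Fin.Properties as FinP using (all?; any?; ¬∀⟶∃¬; toℕ-injective; toℕ<n; combine-injective)
open import Data.Integer as ℤ using (ℤ; +_; -_)
import Data.Integer.Properties as ℤP
open import Data.Integer.Tactic.RingSolver using (solve-∀)
open import Data.List using (List; map; concatMap; filter; cartesianProduct; allFin)
open import Data.List.Membership.Propositional using (_∈_)
open import Data.List.Membership.Propositional.Properties using (∈-allFin; ∈-cartesianProduct⁺; ∈-filter⁺)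
open import Data.List.Relation.Unary.All as All using (All)
open import Data.List.Relation.Unary.Any as Any using (Any)
open import Data.List.Relation.Unary.Any.Properties using (map⁺; concat⁺)
open import Data.Nat as ℕ using (ℕ; zero; suc; _+_; _<_; _<?_)
open import Data.Nat.Induction using (<-wellFounded)
import Data.Nat.Properties as ℕP
import Data.Nat.Tactic.RingSolver as ℕSolver
open import Data.Product using (_×_; _,_; proj₁; proj₂; ∃-syntax)
open import Data.Rational as ℚ using (ℚ; 0ℚ; 1ℚ)
import Data.Rational.Properties as ℚP
open import Data.Sum using (inj₁; inj₂)
open import Data.Unit using (⊤; tt)
open import Data.Vec.Functional using () renaming ([] to []ᵥ; _∷_ to _∷ᵥ_)
open import Function using (_∘_)
open import Induction.WellFounded using (Acc; acc)
open import Relation.Binary.PropositionalEquality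
open import Relation.Nullary using (Dec; yes; no; ¬_; ¬?; contradiction)
open import Relation.Nullary.Decidable using (from-yes; map′; _×-dec_; _→-dec_)
import Algebra.Properties.CommutativeMonoid.Sum ℚP.+-0-commutativeMonoid as Σℚ
import Algebra.Properties.CommutativeMonoid.Sum ℕP.+-0-commutativeMonoid as Σℕ
import Algebra.Properties.Semiring.Sum ℤP.+-*-semiring as Σℤ

swap : ∀ {n} → Fin n → Fin (suc n) → Fin (suc n)
swap zero    zero          = suc zero
swap zero    (suc zero)    = zero
swap zero    (suc (suc i)) = suc (suc i)
swap (suc k) zero          = zero
swap (suc k) (suc i)       = suc (swap k i)

swap-involutive : ∀ {n} (k : Fin n) i → swap k (swap k i) ≡ i
swap-involutive zero    zero          = refl
swap-involutive zero    (suc zero)    = refl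
swap-involutive zero    (suc (suc i)) = refl
swap-involutive (suc k) zero          = refl
swap-involutive (suc k) (suc i)       = cong suc (swap-involutive k i)

swap-equal : ∀ {n} {A : Set} (k : Fin n) (S : Fin (suc n) → A) →
             S (inject₁ k) ≡ S (suc k) → ∀ i → S (swap k i) ≡ S i
swap-equal zero    S e zero          = sym e
swap-equal zero    S e (suc zero)    = e
swap-equal zero    S e (suc (suc i)) = refl
swap-equal (suc k) S e zero          = refl
swap-equal (suc k) S e (suc i)       = swap-equal k (S ∘ suc) e i

module _ {c ℓ} (M : CommutativeMonoid c ℓ) where
  open CommutativeMonoid M
  open import Algebra.Properties.CommutativeMonoid.Sum M using (sum)
  open import Algebra.Properties.CommutativeSemigroup commutativeSemigroup using (x∙yz≈y∙xz)

  sum-swap : ∀ {n} (k : Fin n) (f : Fin (suc n) → Carrier) → sum (f ∘ swap k) ≈ sum f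
  sum-swap zero    f = x∙yz≈y∙xz (f (suc zero)) (f zero) _
  sum-swap (suc k) f = ∙-congˡ (sum-swap k (f ∘ suc))

sumℤ≡sum : ∀ {n} (f : Fin n → ℤ) → sumℤ f ≡ Σℤ.sum f
sumℤ≡sum {zero}  f = refl
sumℤ≡sum {suc n} f = cong (λ t → f zero ℤ.+ t) (sumℤ≡sum (f ∘ suc))

sumℚ≡sum : ∀ {n} (f : Fin n → ℚ) → sumℚ f ≡ Σℚ.sum f
sumℚ≡sum {zero}  f = refl
sumℚ≡sum {suc n} f = cong (λ t → f zero ℚ.+ t) (sumℚ≡sum (f ∘ suc))

sumℤ-cong : ∀ {n} {f g : Fin n → ℤ} → (∀ i → f i ≡ g i) → sumℤ f ≡ sumℤ g
sumℤ-cong {f = f} {g} e = trans (sumℤ≡sum f) (trans (Σℤ.sum-cong-≗ e) (sym (sumℤ≡sum g)))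

sumℤ-+ : ∀ {n} (f g : Fin n → ℤ) → sumℤ (λ i → f i ℤ.+ g i) ≡ sumℤ f ℤ.+ sumℤ g
sumℤ-+ f g = trans (sumℤ≡sum (λ i → f i ℤ.+ g i))
                   (trans (Σℤ.∑-distrib-+ f g) (sym (cong₂ ℤ._+_ (sumℤ≡sum f) (sumℤ≡sum g))))

sumℤ-* : ∀ {n} x (f : Fin n → ℤ) → sumℤ (λ i → x ℤ.* f i) ≡ x ℤ.* sumℤ f
sumℤ-* x f = trans (sumℤ≡sum (λ i → x ℤ.* f i))
                   (trans (sym (Σℤ.*-distribˡ-sum x f)) (cong (x ℤ.*_) (sym (sumℤ≡sum f))))

sumℤ-neg : ∀ {n} (f : Fin n → ℤ) → sumℤ (λ i → - f i) ≡ - sumℤ f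
sumℤ-neg f = begin
  sumℤ (λ i → - f i)         ≡⟨ sumℤ-cong (λ i → sym (ℤP.-1*i≡-i (f i))) ⟩
  sumℤ (λ i → ℤ.-1ℤ ℤ.* f i) ≡⟨ sumℤ-* ℤ.-1ℤ f ⟩
  ℤ.-1ℤ ℤ.* sumℤ f           ≡⟨ ℤP.-1*i≡-i (sumℤ f) ⟩
  - sumℤ f                   ∎
  where open ≡-Reasoning

sumℚ-cong : ∀ {n} {f g : Fin n → ℚ} → (∀ i → f i ≡ g i) → sumℚ f ≡ sumℚ g
sumℚ-cong {f = f} {g} e = trans (sumℚ≡sum f) (trans (Σℚ.sum-cong-≗ e) (sym (sumℚ≡sum g)))

sumℚ-swap : ∀ {n} (k : Fin n) (f : Fin (suc n) → ℚ) → sumℚ (f ∘ swap k) ≡ sumℚ f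
sumℚ-swap k f = trans (sumℚ≡sum (f ∘ swap k))
                      (trans (sum-swap ℚP.+-0-commutativeMonoid k f) (sym (sumℚ≡sum f)))

sgn-suc : ∀ n → sgn (suc n) ≡ - sgn n
sgn-suc zero          = refl
sgn-suc (suc zero)    = refl
sgn-suc (suc (suc n)) = sgn-suc n

det-cong : ∀ {n} {M N : Fin n → Fin n → ℤ} → (∀ i j → M i j ≡ N i j) → det M ≡ det N
det-cong {zero}  e = refl
det-cong {suc n} e = sumℤ-cong (λ j → cong₂ (λ x y → sgn (toℕ j) ℤ.* (x ℤ.* y))
  (e zero j) (det-cong (λ r c → e (suc r) (punchIn j c))))

-- Laplace expansion along two rows a, b: the ordered pair of distinct columns
-- (j, punchIn j c) contributes with the complementary minor A j c. Unfolding
-- det twice gives exactly this expansion for the first two rows.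
expand₂ : ∀ {m} (a b : Fin (suc m) → ℤ) (A : Fin (suc m) → Fin m → ℤ) → ℤ
expand₂ a b A = sumℤ (λ j → sgn (toℕ j) ℤ.* (a j ℤ.* sumℤ (λ c → sgn (toℕ c) ℤ.* (b (punchIn j c) ℤ.* A j c))))

-- A j c depends only on the unordered pair of columns {j, punchIn j c}; stated
-- recursively by first comparing the two orders of the pairs containing column 0.
PairSymmetric : ∀ {m} → (Fin (suc m) → Fin m → ℤ) → Set
PairSymmetric {zero}  A = ⊤
PairSymmetric {suc m} A = (∀ c → A zero c ≡ A (suc c) zero) × PairSymmetric (λ j c → A (suc j) (suc c))

-- Splitting off the pairs of columns that contain column 0; by the symmetry of
-- A these contribute a zero · X b - b zero · X a, which is antisymmetric in a, b.
expand₂-step : ∀ {m} (a b : Fin (suc (suc m)) → ℤ) (A : Fin (suc (suc m)) → Fin (suc m) → ℤ) →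
  (∀ c → A zero c ≡ A (suc c) zero) →
  let X : (Fin (suc (suc m)) → ℤ) → ℤ
      X u = sumℤ (λ c → sgn (toℕ c) ℤ.* (u (suc c) ℤ.* A zero c))
  in expand₂ a b A ≡ a zero ℤ.* X b ℤ.- b zero ℤ.* X a
                     ℤ.+ expand₂ (a ∘ suc) (b ∘ suc) (λ j c → A (suc j) (suc c))
expand₂-step a b A sym₀ = begin
  expand₂ a b A
    ≡⟨ cong (λ t → sgn 0 ℤ.* (a zero ℤ.* X b) ℤ.+ t) (sumℤ-cong term) ⟩
  sgn 0 ℤ.* (a zero ℤ.* X b) ℤ.+ sumℤ (λ j → U j ℤ.+ (- b zero) ℤ.* T j)
    ≡⟨ cong (λ t → sgn 0 ℤ.* (a zero ℤ.* X b) ℤ.+ t)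
         (trans (sumℤ-+ U (λ j → (- b zero) ℤ.* T j)) (cong (λ t → sumℤ U ℤ.+ t) (sumℤ-* (- b zero) T))) ⟩
  sgn 0 ℤ.* (a zero ℤ.* X b) ℤ.+ (sumℤ U ℤ.+ (- b zero) ℤ.* sumℤ T)
    ≡⟨ cong (λ t → sgn 0 ℤ.* (a zero ℤ.* X b) ℤ.+ (sumℤ U ℤ.+ (- b zero) ℤ.* t))
         (sumℤ-cong (λ j → cong (λ t → sgn (toℕ j) ℤ.* (a (suc j) ℤ.* t)) (sym (sym₀ j)))) ⟩
  sgn 0 ℤ.* (a zero ℤ.* X b) ℤ.+ (sumℤ U ℤ.+ (- b zero) ℤ.* X a)
    ≡⟨ rearrange (a zero) (X b) (b zero) (X a) (sumℤ U) ⟩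
  a zero ℤ.* X b ℤ.- b zero ℤ.* X a ℤ.+ sumℤ U ∎
  where
  open ≡-Reasoning
  X : (Fin _ → ℤ) → ℤ
  X u = sumℤ (λ c → sgn (toℕ c) ℤ.* (u (suc c) ℤ.* A zero c))
  -- the terms of the pairs (suc j, suc (punchIn j c)), avoiding column 0
  β : Fin _ → Fin _ → ℤ
  β j c = b (suc (punchIn j c)) ℤ.* A (suc j) (suc c)
  I U T : Fin _ → ℤ
  I j = sumℤ (λ c → sgn (toℕ c) ℤ.* β j c)
  U j = sgn (toℕ j) ℤ.* (a (suc j) ℤ.* I j)
  T j = sgn (toℕ j) ℤ.* (a (suc j) ℤ.* A (suc j) zero)
  shifted : ∀ j → sumℤ (λ c → sgn (suc (toℕ c)) ℤ.* β j c) ≡ - I j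
  shifted j = trans (sumℤ-cong (λ c → trans (cong (ℤ._* β j c) (sgn-suc (toℕ c)))
                                             (sym (ℤP.neg-distribˡ-* (sgn (toℕ c)) (β j c)))))
                    (sumℤ-neg (λ c → sgn (toℕ c) ℤ.* β j c))
  term : ∀ j → sgn (suc (toℕ j)) ℤ.* (a (suc j) ℤ.* (sgn 0 ℤ.* (b zero ℤ.* A (suc j) zero)
               ℤ.+ sumℤ (λ c → sgn (suc (toℕ c)) ℤ.* β j c)))
             ≡ U j ℤ.+ (- b zero) ℤ.* T j
  term j rewrite sgn-suc (toℕ j) | shifted j = distribute (sgn (toℕ j)) (a (suc j)) (b zero) (A (suc j) zero) (I j)
    where
    distribute : ∀ s α β₀ κ ι → - s ℤ.* (α ℤ.* (ℤ.1ℤ ℤ.* (β₀ ℤ.* κ) ℤ.+ - ι))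
                                ≡ s ℤ.* (α ℤ.* ι) ℤ.+ (- β₀) ℤ.* (s ℤ.* (α ℤ.* κ))
    distribute = solve-∀
  rearrange : ∀ α x β y u → ℤ.1ℤ ℤ.* (α ℤ.* x) ℤ.+ (u ℤ.+ (- β) ℤ.* y) ≡ α ℤ.* x ℤ.- β ℤ.* y ℤ.+ u
  rearrange = solve-∀

expand₂-antisym : ∀ {m} (a b : Fin (suc m) → ℤ) (A : Fin (suc m) → Fin m → ℤ) →
                  PairSymmetric A → expand₂ b a A ≡ - expand₂ a b A
expand₂-antisym {zero}  a b A _ = vanish (b zero) (a zero)
  where
  vanish : ∀ x y → ℤ.1ℤ ℤ.* (x ℤ.* + 0) ℤ.+ + 0 ≡ - (ℤ.1ℤ ℤ.* (y ℤ.* + 0) ℤ.+ + 0)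
  vanish = solve-∀
expand₂-antisym {suc m} a b A (sym₀ , symA) = begin
  expand₂ b a A                                                         ≡⟨ expand₂-step b a A sym₀ ⟩
  b zero ℤ.* X a ℤ.- a zero ℤ.* X b ℤ.+ expand₂ (b ∘ suc) (a ∘ suc) A′
    ≡⟨ cong (λ t → b zero ℤ.* X a ℤ.- a zero ℤ.* X b ℤ.+ t) (expand₂-antisym (a ∘ suc) (b ∘ suc) A′ symA) ⟩
  b zero ℤ.* X a ℤ.- a zero ℤ.* X b ℤ.+ - expand₂ (a ∘ suc) (b ∘ suc) A′
    ≡⟨ negate (b zero ℤ.* X a) (a zero ℤ.* X b) (expand₂ (a ∘ suc) (b ∘ suc) A′) ⟩
  - (a zero ℤ.* X b ℤ.- b zero ℤ.* X a ℤ.+ expand₂ (a ∘ suc) (b ∘ suc) A′) ≡⟨ cong -_ (expand₂-step a b A sym₀) ⟨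
  - expand₂ a b A                                                       ∎
  where
  open ≡-Reasoning
  X : (Fin _ → ℤ) → ℤ
  X u = sumℤ (λ c → sgn (toℕ c) ℤ.* (u (suc c) ℤ.* A zero c))
  A′ : Fin (suc m) → Fin m → ℤ
  A′ j c = A (suc j) (suc c)
  negate : ∀ x y z → x ℤ.- y ℤ.+ - z ≡ - (y ℤ.- x ℤ.+ z)
  negate = solve-∀

liftFin : ∀ {n k} → (Fin n → Fin k) → Fin (suc n) → Fin (suc k)
liftFin h zero    = zero
liftFin h (suc d) = suc (h d)

-- Anything determined by the surviving columns punchIn j ∘ punchIn c (such as
-- the minor obtained by deleting columns j and punchIn j c) is pair-symmetric.
complementary-symmetric : ∀ {n} (F : (Fin n → Fin (suc (suc n))) → ℤ) →
  (∀ {h h′} → (∀ d → h d ≡ h′ d) → F h ≡ F h′) →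
  (A : Fin (suc (suc n)) → Fin (suc n) → ℤ) →
  (∀ j c → A j c ≡ F (λ d → punchIn j (punchIn c d))) → PairSymmetric A
complementary-symmetric {zero}  F F-cong A A≡ = (λ c → trans (A≡ zero c) (sym (A≡ (suc c) zero))) , tt
complementary-symmetric {suc n} F F-cong A A≡ =
  (λ c → trans (A≡ zero c) (sym (A≡ (suc c) zero))) ,
  complementary-symmetric (F ∘ liftFin) (λ e → F-cong (lift-cong e)) (λ j c → A (suc j) (suc c))
    (λ j c → trans (A≡ (suc j) (suc c)) (F-cong (punchIn-lift j c)))
  where
  lift-cong : ∀ {h h′ : Fin n → Fin (suc (suc n))} → (∀ d → h d ≡ h′ d) → ∀ d → liftFin h d ≡ liftFin h′ d
  lift-cong e zero    = refl
  lift-cong e (suc d) = cong suc (e d)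
  punchIn-lift : ∀ j c d → punchIn (suc j) (punchIn (suc c) d) ≡ liftFin (λ d′ → punchIn j (punchIn c d′)) d
  punchIn-lift j c zero    = refl
  punchIn-lift j c (suc d) = refl

det-swap₀ : ∀ {n} (M : Fin (suc (suc n)) → Fin (suc (suc n)) → ℤ) → det (λ i → M (swap zero i)) ≡ - det M
det-swap₀ M = expand₂-antisym (M zero) (M (suc zero)) minor₂
  (complementary-symmetric (λ h → det (λ r d → M (suc (suc r)) (h d)))
     (λ e → det-cong (λ r d → cong (M (suc (suc r))) (e d))) minor₂ (λ j c → refl))
  where
  minor₂ : Fin _ → Fin _ → ℤ
  minor₂ j c = det (λ r d → M (suc (suc r)) (punchIn j (punchIn c d)))

-- Exchanging any two adjacent rows negates the determinant: for rows below
-- the first, expand along the first row and use the smaller case on each minor.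
det-swap : ∀ {n} (k : Fin n) (M : Fin (suc n) → Fin (suc n) → ℤ) → det (λ i → M (swap k i)) ≡ - det M
det-swap zero    M = det-swap₀ M
det-swap (suc k) M = begin
  sumℤ (λ j → sgn (toℕ j) ℤ.* (M zero j ℤ.* det (λ r → minor j (swap k r))))
    ≡⟨ sumℤ-cong (λ j → cong (λ t → sgn (toℕ j) ℤ.* (M zero j ℤ.* t)) (det-swap k (minor j))) ⟩
  sumℤ (λ j → sgn (toℕ j) ℤ.* (M zero j ℤ.* - det (minor j)))
    ≡⟨ sumℤ-cong (λ j → pull-neg (sgn (toℕ j)) (M zero j) (det (minor j))) ⟩
  sumℤ (λ j → - (sgn (toℕ j) ℤ.* (M zero j ℤ.* det (minor j))))
    ≡⟨ sumℤ-neg (λ j → sgn (toℕ j) ℤ.* (M zero j ℤ.* det (minor j))) ⟩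
  - det M ∎
  where
  open ≡-Reasoning
  minor : Fin _ → Fin _ → Fin _ → ℤ
  minor j r c = M (suc r) (punchIn j c)
  pull-neg : ∀ s x y → s ℤ.* (x ℤ.* - y) ≡ - (s ℤ.* (x ℤ.* y))
  pull-neg = solve-∀

-- The matrices below are written as explicit λ-terms: this keeps the
-- determinants of size 5 syntactically equal, so the type checker never
-- unfolds them.

class-swap : ∀ v (k : Fin 4) (S : Simplex) → classWrt v (λ j → S (swap k j)) ≡ classWrt v S
class-swap v k S = trans (cong ℤ.∣_∣ (det-swap k (λ i → row v (S i)))) (ℤP.∣-i∣≡∣i∣ (det (λ i → row v (S i))))

class-cong : ∀ v {S S′ : Simplex} → (∀ i → S i ≡ S′ i) → classWrt v S ≡ classWrt v S′
class-cong v {S} {S′} e =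
  cong ℤ.∣_∣ (det-cong {M = λ i → row v (S i)} {N = λ i → row v (S′ i)} (λ r c → cong (λ w → row v w c) (e r)))

-- A repeated (adjacent) vertex makes the determinant equal to its negative, hence 0.
class-repeat : ∀ v (k : Fin 4) (S : Simplex) → S (inject₁ k) ≡ S (suc k) → classWrt v S ≡ 0
class-repeat v k S e = cong ℤ.∣_∣ (self-negating (trans (sym unchanged) (det-swap k (λ i → row v (S i)))))
  where
  unchanged : det (λ i → row v (S (swap k i))) ≡ det (λ i → row v (S i))
  unchanged = det-cong {M = λ i → row v (S (swap k i))} {N = λ i → row v (S i)}
                (λ r c → cong (λ w → row v w c) (swap-equal k S e r))
  self-negating : ∀ {x} → x ≡ - x → x ≡ + 0
  self-negating {+ zero}     _  = refl
  self-negating {+ suc _}    ()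
  self-negating {ℤ.-[1+ _ ]} ()

facet-swap : ∀ {x} (k : Fin 4) (S : Simplex) (i : Fin 5) →
             InRelIntFacet x (λ j → S (swap k j)) i → InRelIntFacet x S (swap k i)
facet-swap k S i (μ , μᵢ≡0 , μ>0 , Σμ≡1 , x≡) =
  (λ j → μ (swap k j)) ,
  trans (cong μ (swap-involutive k i)) μᵢ≡0 ,
  (λ j j≢ → μ>0 (swap k j) (λ e → j≢ (trans (sym (swap-involutive k j)) (cong (swap k) e)))) ,
  trans (sumℚ-swap k μ) Σμ≡1 ,
  (λ c → trans (x≡ c) (trans (sumℚ-cong (λ j → cong (λ t → μ t ℚ.* vertexPt (S (swap k j)) c) (sym (swap-involutive k j))))
                             (sumℚ-swap k (λ j → μ (swap k j) ℚ.* vertexPt (S j) c))))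

facet-cong : ∀ {x} {S S′ : Simplex} → (∀ i → S i ≡ S′ i) → ∀ i → InRelIntFacet x S i → InRelIntFacet x S′ i
facet-cong e i (μ , μᵢ≡0 , μ>0 , Σμ≡1 , x≡) =
  μ , μᵢ≡0 , μ>0 , Σμ≡1 , (λ c → trans (x≡ c) (sumℚ-cong (λ j → cong (λ w → μ j ℚ.* vertexPt w c) (e j))))

-- The weight
-- Σᵢ i · code (S i) strictly drops when an ascending adjacent pair is exchanged,
-- so a property that is reflected by adjacent exchanges, holds whenever two
-- adjacent entries coincide, and holds for strictly decreasing tuples, holds
-- for all tuples.

module SortingInduction {a} {A : Set a} (code : A → ℕ) (code-injective : ∀ {x y} → code x ≡ code y → x ≡ y) where

  StrictlyDecreasing : ∀ {n} → (Fin (suc n) → A) → Set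
  StrictlyDecreasing S = ∀ k → code (S (suc k)) < code (S (inject₁ k))

  total : ∀ {n} → (Fin n → A) → ℕ
  total S = Σℕ.sum (λ i → code (S i))

  -- weight S = Σᵢ i · code (S i)
  weight : ∀ {n} → (Fin n → A) → ℕ
  weight {zero}  S = 0
  weight {suc n} S = weight (S ∘ suc) + total (S ∘ suc)

  weight-swap : ∀ {n} (k : Fin n) (S : Fin (suc n) → A) →
                weight (S ∘ swap k) + code (S (suc k)) ≡ weight S + code (S (inject₁ k))
  weight-swap zero    S =
    exchange (weight (λ i → S (suc (suc i)))) (total (λ i → S (suc (suc i)))) (code (S zero)) (code (S (suc zero)))
    where
    exchange : ∀ w t c₀ c₁ → (w + t) + (c₀ + t) + c₁ ≡ (w + t) + (c₁ + t) + c₀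
    exchange = ℕSolver.solve-∀
  weight-swap (suc k) S = begin
    weight (S ∘ suc ∘ swap k) + total (S ∘ suc ∘ swap k) + code (S (suc (suc k)))
      ≡⟨ cong (λ t → weight (S ∘ suc ∘ swap k) + t + code (S (suc (suc k))))
              (sum-swap ℕP.+-0-commutativeMonoid k (code ∘ S ∘ suc)) ⟩
    weight (S ∘ suc ∘ swap k) + total (S ∘ suc) + code (S (suc (suc k)))
      ≡⟨ swap-last (weight (S ∘ suc ∘ swap k)) (total (S ∘ suc)) (code (S (suc (suc k)))) ⟩
    weight (S ∘ suc ∘ swap k) + code (S (suc (suc k))) + total (S ∘ suc)
      ≡⟨ cong (_+ total (S ∘ suc)) (weight-swap k (S ∘ suc)) ⟩
    weight (S ∘ suc) + code (S (suc (inject₁ k))) + total (S ∘ suc)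
      ≡⟨ swap-last (weight (S ∘ suc)) (code (S (suc (inject₁ k)))) (total (S ∘ suc)) ⟩
    weight (S ∘ suc) + total (S ∘ suc) + code (S (suc (inject₁ k))) ∎
    where
    open ≡-Reasoning
    swap-last : ∀ x y z → x + y + z ≡ x + z + y
    swap-last = ℕSolver.solve-∀

  -- Either the tuple is strictly decreasing, or its first non-descent is a
  -- repetition, or exchanging it gives a tuple of smaller weight.
  sort-induction : ∀ {n ℓ} (P : (Fin (suc n) → A) → Set ℓ) →
    (∀ k S → P (λ i → S (swap k i)) → P S) →
    (∀ k S → S (inject₁ k) ≡ S (suc k) → P S) →
    (∀ S → StrictlyDecreasing S → P S) →
    ∀ S → P S
  sort-induction {n} P swap-closed repeat decreasing S = go S (<-wellFounded (weight S))
    where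
    go : ∀ S → Acc _<_ (weight S) → P S
    go S (acc smaller) with all? (λ k → code (S (suc k)) <? code (S (inject₁ k)))
    ... | yes sorted = decreasing S sorted
    ... | no unsorted with ¬∀⟶∃¬ n _ (λ k → code (S (suc k)) <? code (S (inject₁ k))) unsorted
    ...   | k , ≮ with ℕP.m≤n⇒m<n∨m≡n (ℕP.≮⇒≥ ≮)
    ...     | inj₂ same      = repeat k S (code-injective same)
    ...     | inj₁ ascending = swap-closed k S (go (λ i → S (swap k i)) (smaller lighter))
      where
      lighter : weight (λ i → S (swap k i)) < weight S
      lighter = ℕP.+-cancelʳ-< (code (S (suc k))) (weight (λ i → S (swap k i))) (weight S)
                  (subst (_< weight S + code (S (suc k))) (sym (weight-swap k S)) (ℕP.+-monoʳ-< (weight S) ascending))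

vertices : List Vertex
vertices = cartesianProduct (allFin 2) (cartesianProduct (allFin 2) (allFin 3))

∈-vertices : ∀ w → w ∈ vertices
∈-vertices (a , b , c) = ∈-cartesianProduct⁺ (∈-allFin a) (∈-cartesianProduct⁺ (∈-allFin b) (∈-allFin c))

code : Vertex → ℕ
code (a , b , c) = toℕ (combine a (combine b c))

code-injective : ∀ {w w′} → code w ≡ code w′ → w ≡ w′
code-injective {a , b , c} {a′ , b′ , c′} e with combine-injective a (combine b c) a′ (combine b′ c′) (toℕ-injective e)
... | refl , e′ with combine-injective b c b′ c′ e′
...   | refl , refl = refl

code-bound : ∀ w → code w < 12
code-bound (a , b , c) = toℕ<n (combine a (combine b c))

open SortingInduction code code-injective

under : ℕ → List Vertex
under m = filter (λ w → code w <? m) vertices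

chains : ∀ n → ℕ → List (Fin (suc n) → Vertex)
chains zero    m = map (λ w → w ∷ᵥ []ᵥ) (under m)
chains (suc n) m = concatMap (λ w → map (w ∷ᵥ_) (chains n (code w))) (under m)

chains-complete : ∀ n m (S : Fin (suc n) → Vertex) → code (S zero) < m → StrictlyDecreasing S →
                  Any (λ T → ∀ i → T i ≡ S i) (chains n m)
chains-complete zero    m S S₀<m _   =
  map⁺ (Any.map (λ { refl zero → refl }) (∈-filter⁺ (λ w → code w <? m) (∈-vertices (S zero)) S₀<m))
chains-complete (suc n) m S S₀<m dec =
  concat⁺ (map⁺ (Any.map (λ { refl → map⁺ (Any.map extend rest) }) (∈-filter⁺ (λ w → code w <? m) (∈-vertices (S zero)) S₀<m)))
  where
  rest : Any (λ T → ∀ i → T i ≡ S (suc i)) (chains n (code (S zero)))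
  rest = chains-complete n (code (S zero)) (S ∘ suc) (dec zero) (dec ∘ suc)
  extend : ∀ {T} → (∀ i → T i ≡ S (suc i)) → ∀ i → (S zero ∷ᵥ T) i ≡ S i
  extend e zero    = refl
  extend e (suc i) = e i

v₀ : Vertex
v₀ = zero , zero , zero

-- 6 · (1 | reduced coordinates of the centre with respect to v₀)
centreRow : Fin 5 → ℤ
centreRow zero                = + 6
centreRow (suc zero)          = + 3
centreRow (suc (suc zero))    = + 3
centreRow (suc (suc (suc _))) = + 2

-- Cramer's rule for the barycentric coordinates of the centre: the i-th one is
-- det (rows with row i replaced by centreRow) / (6 · det rows). For a simplex of
-- class 2, det rows = ±2 and so 1 / (6 · det rows) = det rows / 24.
barycentre₂ : Simplex → Fin 5 → ℚ
barycentre₂ S i = (det replaced ℤ.* det (λ r → row v₀ (S r))) ℚ./ 24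
  where
  replaced : Fin 5 → Fin 5 → ℤ
  replaced r with r FinP.≟ i
  ... | yes _ = centreRow
  ... | no  _ = row v₀ (S r)

FacetConditions : Point → Simplex → (Fin 5 → ℚ) → Fin 5 → Set
FacetConditions x S μ i = μ i ≡ 0ℚ × (∀ j → ¬ j ≡ i → 0ℚ ℚ.< μ j) × sumℚ μ ≡ 1ℚ × (∀ k → x k ≡ comb S μ k)

all-coords? : {P : Coord → Set} → (∀ k → Dec (P k)) → Dec (∀ k → P k)
all-coords? P? = map′ (λ { (p₁ , p₂ , p₃) → λ { (c₁ i) → p₁ i ; (c₂ i) → p₂ i ; (c₃ i) → p₃ i } })
                      (λ p → (p ∘ c₁) , (p ∘ c₂) , (p ∘ c₃))
                      (all? (P? ∘ c₁) ×-dec (all? (P? ∘ c₂) ×-dec all? (P? ∘ c₃)))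

facetConditions? : ∀ x S μ i → Dec (FacetConditions x S μ i)
facetConditions? x S μ i =
  (μ i ℚP.≟ 0ℚ) ×-dec (all? (λ j → ¬? (j FinP.≟ i) →-dec (0ℚ ℚP.<? μ j)) ×-dec
  ((sumℚ μ ℚP.≟ 1ℚ) ×-dec all-coords? (λ k → x k ℚP.≟ comb S μ k)))

-- The two facts below are established by evaluating the decision procedures;
-- they are opaque so that later uses never re-run the computation.
opaque
  class-two-base : All (λ v → All (λ T → classWrt v T ≡ 2 → classWrt v₀ T ≡ 2) (chains 4 12)) vertices
  class-two-base =
    from-yes (All.all? (λ v → All.all? (λ T → (classWrt v T ℕ.≟ 2) →-dec (classWrt v₀ T ℕ.≟ 2)) (chains 4 12)) vertices)

  class-two-facet : All (λ T → classWrt v₀ T ≡ 2 → ∃[ i ] FacetConditions center T (barycentre₂ T) i) (chains 4 12)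
  class-two-facet =
    from-yes (All.all? (λ T → (classWrt v₀ T ℕ.≟ 2) →-dec any? (facetConditions? center T (barycentre₂ T))) (chains 4 12))

HasCentredFacet : Vertex → Simplex → Set
HasCentredFacet v S = classWrt v S ≡ 2 → ∃[ i ] InRelIntFacet center S i

centred-swap : ∀ v k S → HasCentredFacet v (λ j → S (swap k j)) → HasCentredFacet v S
centred-swap v k S centred class₂ = swap k (proj₁ found) , facet-swap k S (proj₁ found) (proj₂ found)
  where
  found : ∃[ i ] InRelIntFacet center (λ j → S (swap k j)) i
  found = centred (trans (class-swap v k S) class₂)

-- a simplex with a repeated vertex has class 0, so the claim is vacuous
centred-repeat : ∀ v k S → S (inject₁ k) ≡ S (suc k) → HasCentredFacet v S
centred-repeat v k S e class₂ = contradiction (trans (sym class₂) (class-repeat v k S e)) λ ()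

chain-representative : ∀ {P : Simplex → Set} → All P (chains 4 12) →
                       ∀ S → StrictlyDecreasing S → ∃[ T ] (P T × (∀ i → T i ≡ S i))
chain-representative checked S dec = Any.lookup found , All.lookupAny checked found
  where
  found : Any (λ T → ∀ i → T i ≡ S i) (chains 4 12)
  found = chains-complete 4 12 S (code-bound (S zero)) dec

centred-representative : ∀ v {S} T → (classWrt v T ≡ 2 → classWrt v₀ T ≡ 2) →
  (classWrt v₀ T ≡ 2 → ∃[ i ] FacetConditions center T (barycentre₂ T) i) →
  (∀ i → T i ≡ S i) → HasCentredFacet v S
centred-representative v {S} T base certified T≗S class₂ =
  proj₁ certificate , facet-cong {S = T} {S} T≗S (proj₁ certificate) (barycentre₂ T , proj₂ certificate)
  where
  certificate : ∃[ i ] FacetConditions center T (barycentre₂ T) i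
  certificate = certified (base (trans (class-cong v {T} {S} T≗S) class₂))

centred-decreasing : ∀ v S → StrictlyDecreasing S → HasCentredFacet v S
centred-decreasing v S dec =
  let T , (base , certified) , T≗S = chain-representative {P = Checked}
                                       (All.zip (All.lookup class-two-base (∈-vertices v) , class-two-facet)) S dec
  in centred-representative v T base certified T≗S
  where
  Checked : Simplex → Set
  Checked T = (classWrt v T ≡ 2 → classWrt v₀ T ≡ 2) × (classWrt v₀ T ≡ 2 → ∃[ i ] FacetConditions center T (barycentre₂ T) i)

proposition19 : (v : Vertex) (L : List Simplex) → IsCover L →
                (S : Simplex) → S ∈ L → classWrt v S ≡ 2 →
                ∃[ i ] InRelIntFacet center S i
proposition19 v _ _ S _ =
  sort-induction (HasCentredFacet v) (centred-swap v) (centred-repeat v) (centred-decreasing v) S
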